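{- Let $G,H$ be Left dead-ends with $G\not\cong0$ and $H\not\cong0$. Then for every Left dead-end $K$ with $K\equiv_{\mathcal{M}}G+H$, the game $0$ is not a Right option of $K$.
   Context: Games are finite partizan games; $G\cong H$ means identical game trees; $0=\{\cdot\mid\cdot\}$. Sum $G+H=\{G^L+H,G+H^L\mid G^R+H,G+H^R\}$. Misère outcomes: $o^L(G)=\mathscr{L}$ iff $G$ has no Left option or some $o^R(G^L)=\mathscr{L}$ (else $\mathscr{R}$); $o^R(G)=\mathscr{R}$ iff $G$ has no Right option or some $o^L(G^R)=\mathscr{R}$ (else $\mathscr{L}$); $o(G)$ is the pair $(o^L(G),o^R(G))$. $G\equiv_{\mathcal{M}}H$ means $o(G+X)=o(H+X)$ for every game $X$. A Left dead-end is a game all of whose subpositions have no Left option. -}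

module Defs where

open import Data.List using (List; []; _∷_; _++_)
open import Data.List.Relation.Unary.All using (All)
open import Data.Product using (_×_; _,_)
open import Relation.Binary.PropositionalEquality using (_≡_)

-- Finite partizan game trees: a list of Left options and a list of Right options.
-- Identity of game trees (G ≅ H) is propositional equality _≡_ on this type.
data Game : Set where
  ⟨_∣_⟩ : List Game → List Game → Game

lefts : Game → List Game
lefts ⟨ l ∣ r ⟩ = l

rights : Game → List Game
rights ⟨ l ∣ r ⟩ = r

zero : Game
zero = ⟨ [] ∣ [] ⟩

mutual
  _⊕_ : Game → Game → Game
  ⟨ gl ∣ gr ⟩ ⊕ ⟨ hl ∣ hr ⟩ =
    ⟨ addˡ gl ⟨ hl ∣ hr ⟩ ++ addʳ ⟨ gl ∣ gr ⟩ hl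
    ∣ addˡ gr ⟨ hl ∣ hr ⟩ ++ addʳ ⟨ gl ∣ gr ⟩ hr ⟩

  addˡ : List Game → Game → List Game
  addˡ [] h = []
  addˡ (g ∷ gs) h = (g ⊕ h) ∷ addˡ gs h

  addʳ : Game → List Game → List Game
  addʳ g [] = []
  addʳ g (h ∷ hs) = (g ⊕ h) ∷ addʳ g hs

data Player : Set where
  𝓛 𝓡 : Player

-- Misère outcomes.
-- o^L(G) = 𝓛 iff G has no Left option or some o^R(G^L) = 𝓛 (else 𝓡);
-- o^R(G) = 𝓡 iff G has no Right option or some o^L(G^R) = 𝓡 (else 𝓛).
mutual
  oL : Game → Player
  oL ⟨ [] ∣ r ⟩ = 𝓛
  oL ⟨ g ∷ gs ∣ r ⟩ = someRisL (g ∷ gs)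

  oR : Game → Player
  oR ⟨ l ∣ [] ⟩ = 𝓡
  oR ⟨ l ∣ g ∷ gs ⟩ = someLisR (g ∷ gs)

  someRisL : List Game → Player
  someRisL [] = 𝓡
  someRisL (g ∷ gs) with oR g
  ... | 𝓛 = 𝓛
  ... | 𝓡 = someRisL gs

  someLisR : List Game → Player
  someLisR [] = 𝓛
  someLisR (g ∷ gs) with oL g
  ... | 𝓡 = 𝓡
  ... | 𝓛 = someLisR gs

o : Game → Player × Player
o g = oL g , oR g

-- misère equivalence (over the full universe of games)
_≡ₘ_ : Game → Game → Set
g ≡ₘ h = ∀ (x : Game) → o (g ⊕ x) ≡ o (h ⊕ x)

data LeftDeadEnd : Game → Set where
  lde : ∀ {r} → All LeftDeadEnd r → LeftDeadEnd ⟨ [] ∣ r ⟩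

-- Let 1 = {0 | ·} be the distinguishing game. If 0 is a Right option of K, Right moves
-- from K + 1 to 0 + 1 = 1, where Left, whose only move is to 0, loses in misère play; so
-- Right wins K + 1 moving first. Nonzero Left dead-ends G and H both have Right options,
-- hence so does every Right option P of G + H. Right has to move G + H + 1 to such a
-- P + 1, Left answers P + 0 and Right, forced to move in the Left dead-end P, hands
-- Left a position without Left moves; so Right loses G + H + 1 moving first.
module Submission where

open import Defs
open import Data.List using (List; []; _∷_; _++_; map)
open import Data.List.Membership.Propositional using (_∈_; lose)
open import Data.List.Membership.Propositional.Properties using (∈-map⁺)
open import Data.List.Relation.Unary.All using (All; []; _∷_)
import Data.List.Relation.Unary.All as All
import Data.List.Relation.Unary.All.Properties as All
open import Data.List.Relation.Unary.Any using (Any; here; there)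
import Data.List.Relation.Unary.Any.Properties as Any
open import Data.Product using (_,_; proj₂)
open import Relation.Binary.PropositionalEquality
  using (_≡_; _≢_; refl; sym; cong; cong₂; subst; module ≡-Reasoning)
open import Function using (_$_)
open import Relation.Nullary using (¬_)

addˡ-map : ∀ gs h → addˡ gs h ≡ map (_⊕ h) gs
addˡ-map []       h = refl
addˡ-map (g ∷ gs) h = cong (g ⊕ h ∷_) (addˡ-map gs h)

addʳ-map : ∀ g hs → addʳ g hs ≡ map (g ⊕_) hs
addʳ-map g []       = refl
addʳ-map g (h ∷ hs) = cong (g ⊕ h ∷_) (addʳ-map g hs)

rights-⊕ : ∀ g h → rights (g ⊕ h) ≡ map (_⊕ h) (rights g) ++ map (g ⊕_) (rights h)
rights-⊕ g@(⟨ gl ∣ gr ⟩) h@(⟨ hl ∣ hr ⟩) = cong₂ _++_ (addˡ-map gr h) (addʳ-map g hr)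

HasRightOption : Game → Set
HasRightOption g = rights g ≢ []

⊕-hasRightOptionˡ : ∀ g h → HasRightOption g → HasRightOption (g ⊕ h)
⊕-hasRightOptionˡ ⟨ gl ∣ [] ⟩    h            ne = λ _ → ne refl
⊕-hasRightOptionˡ ⟨ gl ∣ _ ∷ _ ⟩ ⟨ hl ∣ hr ⟩ _  = λ ()

⊕-hasRightOptionʳ : ∀ g h → HasRightOption h → HasRightOption (g ⊕ h)
⊕-hasRightOptionʳ ⟨ gl ∣ []    ⟩ ⟨ hl ∣ [] ⟩    ne = λ _ → ne refl
⊕-hasRightOptionʳ ⟨ gl ∣ []    ⟩ ⟨ hl ∣ _ ∷ _ ⟩ _  = λ ()
⊕-hasRightOptionʳ ⟨ gl ∣ _ ∷ _ ⟩ ⟨ hl ∣ hr ⟩    _  = λ ()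

rightOptions-⊕-hasRightOption : ∀ g h → HasRightOption g → HasRightOption h →
                                All HasRightOption (rights (g ⊕ h))
rightOptions-⊕-hasRightOption g h g-ne h-ne =
  subst (All HasRightOption) (sym (rights-⊕ g h))
    (All.++⁺ (All.map⁺ (All.universal (λ gʳ → ⊕-hasRightOptionʳ gʳ h h-ne) (rights g)))
             (All.map⁺ (All.universal (λ hʳ → ⊕-hasRightOptionˡ g hʳ g-ne) (rights h))))

someLisR-all𝓛 : ∀ {xs} → All (λ x → oL x ≡ 𝓛) xs → someLisR xs ≡ 𝓛
someLisR-all𝓛 []                  = refl
someLisR-all𝓛 {x ∷ _} (oLx≡𝓛 ∷ ps) rewrite oLx≡𝓛 = someLisR-all𝓛 ps

someLisR-any𝓡 : ∀ {xs} → Any (λ x → oL x ≡ 𝓡) xs → someLisR xs ≡ 𝓡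
someLisR-any𝓡         (here oLx≡𝓡) rewrite oLx≡𝓡 = refl
someLisR-any𝓡 {x ∷ _} (there p) with oL x
... | 𝓡 = refl
... | 𝓛 = someLisR-any𝓡 p

someRisL-any𝓛 : ∀ {xs} → Any (λ x → oR x ≡ 𝓛) xs → someRisL xs ≡ 𝓛
someRisL-any𝓛         (here oRx≡𝓛) rewrite oRx≡𝓛 = refl
someRisL-any𝓛 {x ∷ _} (there p) with oR x
... | 𝓛 = refl
... | 𝓡 = someRisL-any𝓛 p

oR≡𝓛 : ∀ g → HasRightOption g → All (λ x → oL x ≡ 𝓛) (rights g) → oR g ≡ 𝓛
oR≡𝓛 ⟨ _ ∣ [] ⟩    ne _ with () ← ne refl
oR≡𝓛 ⟨ _ ∣ _ ∷ _ ⟩ _  ps = someLisR-all𝓛 ps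

oR≡𝓡 : ∀ g → Any (λ x → oL x ≡ 𝓡) (rights g) → oR g ≡ 𝓡
oR≡𝓡 ⟨ _ ∣ _ ∷ _ ⟩ p = someLisR-any𝓡 p

oL≡𝓛 : ∀ g → Any (λ x → oR x ≡ 𝓛) (lefts g) → oL g ≡ 𝓛
oL≡𝓛 ⟨ _ ∷ _ ∣ _ ⟩ p = someRisL-any𝓛 p

mutual
  ⊕-leftDeadEnd : ∀ {g h} → LeftDeadEnd g → LeftDeadEnd h → LeftDeadEnd (g ⊕ h)
  ⊕-leftDeadEnd g-de@(lde gʳ-de) h-de@(lde hʳ-de) =
    lde (All.++⁺ (addˡ-leftDeadEnd gʳ-de h-de) (addʳ-leftDeadEnd g-de hʳ-de))

  addˡ-leftDeadEnd : ∀ {gs h} → All LeftDeadEnd gs → LeftDeadEnd h → All LeftDeadEnd (addˡ gs h)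
  addˡ-leftDeadEnd []             h-de = []
  addˡ-leftDeadEnd (g-de ∷ gs-de) h-de = ⊕-leftDeadEnd g-de h-de ∷ addˡ-leftDeadEnd gs-de h-de

  addʳ-leftDeadEnd : ∀ {g hs} → LeftDeadEnd g → All LeftDeadEnd hs → All LeftDeadEnd (addʳ g hs)
  addʳ-leftDeadEnd g-de []             = []
  addʳ-leftDeadEnd g-de (h-de ∷ hs-de) = ⊕-leftDeadEnd g-de h-de ∷ addʳ-leftDeadEnd g-de hs-de

leftDeadEnd-hasRightOption : ∀ {g} → LeftDeadEnd g → g ≢ zero → HasRightOption g
leftDeadEnd-hasRightOption (lde {[]} _) g≢0 _ = g≢0 refl
leftDeadEnd-hasRightOption (lde {_ ∷ _} _) _ ()

oL-leftDeadEnd : ∀ {g} → LeftDeadEnd g → oL g ≡ 𝓛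
oL-leftDeadEnd (lde _) = refl

oR-leftDeadEnd : ∀ {g} → LeftDeadEnd g → HasRightOption g → oR g ≡ 𝓛
oR-leftDeadEnd {g} (lde gʳ-de) ne = oR≡𝓛 g ne (All.map oL-leftDeadEnd gʳ-de)

𝓡≢𝓛 : 𝓡 ≢ 𝓛
𝓡≢𝓛 ()

one : Game
one = ⟨ zero ∷ [] ∣ [] ⟩

oR-⊕one-0∈rights : ∀ k → zero ∈ rights k → oR (k ⊕ one) ≡ 𝓡
oR-⊕one-0∈rights k 0∈kʳ =
  oR≡𝓡 (k ⊕ one)
    (subst (Any (λ x → oL x ≡ 𝓡)) (sym (rights-⊕ k one))
      (Any.++⁺ˡ (lose (∈-map⁺ (_⊕ one) 0∈kʳ) refl)))

-- Matching on lefts p = [] makes lefts (p ⊕ one) compute to p ⊕ zero ∷ [].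
oL-⊕one-leftDeadEnd : ∀ {p} → LeftDeadEnd p → HasRightOption p → oL (p ⊕ one) ≡ 𝓛
oL-⊕one-leftDeadEnd {p@(⟨ [] ∣ _ ⟩)} p-de ne =
  oL≡𝓛 (p ⊕ one)
    (here (oR-leftDeadEnd (⊕-leftDeadEnd p-de (lde [])) (⊕-hasRightOptionˡ p zero ne)))

oR-⊕one-leftDeadEnd : ∀ {q} → LeftDeadEnd q → HasRightOption q →
                      All HasRightOption (rights q) → oR (q ⊕ one) ≡ 𝓛
oR-⊕one-leftDeadEnd {q} (lde qʳ-de) ne qʳ-ne =
  oR≡𝓛 (q ⊕ one) (⊕-hasRightOptionˡ q one ne)
    (subst (All (λ x → oL x ≡ 𝓛)) (sym (rights-⊕ q one))
      (All.++⁺ (All.map⁺ (All.zipWith (λ (d , n) → oL-⊕one-leftDeadEnd d n) (qʳ-de , qʳ-ne))) []))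

proposition3p9 : ∀ (G H : Game) → LeftDeadEnd G → LeftDeadEnd H
                 → G ≢ zero → H ≢ zero
                 → ∀ (K : Game) → LeftDeadEnd K → K ≡ₘ (G ⊕ H)
                 → ¬ (zero ∈ rights K)
proposition3p9 G H G-de H-de G≢0 H≢0 K _ K≡G+H 0∈Kʳ = 𝓡≢𝓛 $
  begin
    𝓡                  ≡⟨ sym (oR-⊕one-0∈rights K 0∈Kʳ) ⟩
    oR (K ⊕ one)       ≡⟨ cong proj₂ (K≡G+H one) ⟩
    oR ((G ⊕ H) ⊕ one) ≡⟨ oR-⊕one-leftDeadEnd (⊕-leftDeadEnd G-de H-de)
                            (⊕-hasRightOptionˡ G H G-ne)
                            (rightOptions-⊕-hasRightOption G H G-ne H-ne) ⟩
    𝓛                  ∎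
  where
    open ≡-Reasoning
    G-ne : HasRightOption G
    G-ne = leftDeadEnd-hasRightOption G-de G≢0
    H-ne : HasRightOption H
    H-ne = leftDeadEnd-hasRightOption H-de H≢0
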